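{- Let $(a,b)$ and $(a',b)$ be two different loop-digraphic lists of length $n$ such that $a$ is obtained from $a'$ by a unit $(i,j)$-transfer, and let $G'_1\ne G'_2$ be loop-digraph realizations of $(a',b)$. Then $\mathrm{Shift}_{i,j}(G'_1,(a,b))\cap\mathrm{Shift}_{i,j}(G'_2,(a,b))\ne\emptyset$ if and only if there are vertices $k\ne k'$ such that $A(G'_1)\,\Delta\,A(G'_2)=\{(k,i),(k',j),(k,j),(k',i)\}$ with $(k,i),(k',j)\in A(G'_1)\setminus A(G'_2)$ and $(k,j),(k',i)\in A(G'_2)\setminus A(G'_1)$.
   Context: $(a,b)$ denotes $((a_1,b_1),\dots,(a_n,b_n))$ with nonnegative integers. A loop-digraph realization of $(a,b)$ is a digraph $G$ with arc set $A(G)$ on vertices $1,\dots,n$, without multiple arcs and with at most one loop per vertex, with indegree $a_i$ and outdegree $b_i$ at vertex $i$; its adjacency matrix has $A_{ki}=1$ iff $(k,i)\in A(G)$ (row sums $b$, column sums $a$). $(a,b)$ is loop-digraphic if it has such a realization. Unit $(i,j)$-transfer: for $i<j$ with $a'_i\ge a'_j+2$, $a=a'-e_i+e_j$. An $(i,j)$-shift on a realization $G'$ of $(a',b)$ changes, for one row $k$ with $A'_{ki}=1$ and $A'_{kj}=0$, these entries to $A'_{ki}=0$, $A'_{kj}=1$ (i.e., replaces arc $(k,i)$ by $(k,j)$); the result is a realization of $(a,b)$. $\mathrm{Shift}_{i,j}(G',(a,b))$ is the set of realizations of $(a,b)$ obtained from $G'$ by a single $(i,j)$-shift. $\Delta$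 denotes symmetric difference. -}

module Defs where

open import Data.Nat using (ℕ; _+_; _<_; _≥_)
open import Data.Bool using (Bool; true; false; if_then_else_)
open import Data.Fin using (Fin; toℕ)
open import Data.List using (List; map; allFin)
open import Data.Nat.ListAction using (sum)
open import Data.Product using (_×_; Σ; ∃; ∃-syntax; _,_)
open import Data.Sum using (_⊎_)
open import Relation.Binary.PropositionalEquality using (_≡_; _≢_)
open import Relation.Nullary using (¬_)

DegVec : ℕ → Set
DegVec n = Fin n → ℕ

-- A loop-digraph on vertices Fin n, given by its adjacency matrix:
-- A k i = true iff (k,i) is an arc.  A Boolean matrix automatically has
-- no multiple arcs and at most one loop per vertex.
LoopDigraph : ℕ → Set
LoopDigraph n = Fin n → Fin n → Bool

b2n : Bool → ℕ
b2n true  = 1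
b2n false = 0

outdeg : ∀ {n} → LoopDigraph n → Fin n → ℕ
outdeg {n} A k = sum (map (λ y → b2n (A k y)) (allFin n))

indeg : ∀ {n} → LoopDigraph n → Fin n → ℕ
indeg {n} A i = sum (map (λ x → b2n (A x i)) (allFin n))

Realizes : ∀ {n} → LoopDigraph n → DegVec n → DegVec n → Set
Realizes G a b = (∀ v → indeg G v ≡ a v) × (∀ v → outdeg G v ≡ b v)

LoopDigraphic : ∀ {n} → DegVec n → DegVec n → Set
LoopDigraphic {n} a b = Σ (LoopDigraph n) λ G → Realizes G a b

UnitTransfer : ∀ {n} → Fin n → Fin n → DegVec n → DegVec n → Set
UnitTransfer i j a' a =
  (toℕ i < toℕ j) × (a' i ≥ a' j + 2) ×
  (a i + 1 ≡ a' i) × (a j ≡ a' j + 1) ×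
  (∀ v → v ≢ i → v ≢ j → a v ≡ a' v)

SameGraph : ∀ {n} → LoopDigraph n → LoopDigraph n → Set
SameGraph G H = ∀ x y → G x y ≡ H x y

ShiftAt : ∀ {n} → Fin n → Fin n → Fin n → LoopDigraph n → LoopDigraph n → Set
ShiftAt i j k G' G =
  (G' k i ≡ true) × (G' k j ≡ false) ×
  (G k i ≡ false) × (G k j ≡ true) ×
  (∀ x y → ¬ (x ≡ k × y ≡ i) → ¬ (x ≡ k × y ≡ j) → G x y ≡ G' x y)

InShift : ∀ {n} → Fin n → Fin n → LoopDigraph n → DegVec n → DegVec n →
          LoopDigraph n → Set
InShift i j G' a b G = Realizes G a b × ∃[ k ] ShiftAt i j k G' G

InSymDiff : ∀ {n} → LoopDigraph n → LoopDigraph n → Fin n → Fin n → Set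
InSymDiff G1 G2 x y = G1 x y ≢ G2 x y

InFour : ∀ {n} → Fin n → Fin n → Fin n → Fin n → Fin n → Fin n → Set
InFour i j k k' x y =
  ((x ≡ k) × (y ≡ i)) ⊎ ((x ≡ k') × (y ≡ j)) ⊎
  ((x ≡ k) × (y ≡ j)) ⊎ ((x ≡ k') × (y ≡ i))

-- A shift of a realization of (a′,b) moves one unit of indegree from i to j and keeps all
-- outdegrees, so it realizes (a,b). If G is a shift of G₁ at row k and of G₂ at row k′, then
-- G₁ and G₂ agree with G, hence with each other, off the arcs (k,i), (k,j), (k′,i), (k′,j),
-- where the two shifts pin down their values; k = k′ would force G₁ = G₂. Conversely, when
-- G₁ and G₂ differ by this four-arc switch, the shift of G₁ at row k is also the shift of G₂
-- at row k′.
module Submission where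

open import Defs
open import Data.Bool using (Bool; true; false; _∨_)
open import Data.Bool.Properties using (∨-idem; ∨-zeroʳ) renaming (_≟_ to _≟ᴮ_)
open import Data.Fin using (Fin; zero; suc; punchIn)
open import Data.Fin.Properties using (_≟_; punchInᵢ≢i)
open import Data.List using (map; allFin; tabulate)
open import Data.List.Properties using (map-tabulate)
open import Data.Nat using (ℕ; suc; _+_)
open import Data.Nat.ListAction using (sum)
open import Data.Nat.Properties using (+-comm; suc-injective; +-0-commutativeMonoid)
open import Algebra.Properties.CommutativeMonoid.Sum +-0-commutativeMonoid
  using (sum-remove; sum-cong-≗) renaming (sum to ∑)
open import Data.Product using (_×_; ∃-syntax; _,_; proj₁; proj₂)
open import Data.Sum using (inj₁; inj₂)
open import Function using (_∘_)
open import Function.Bundles using (_⇔_; mk⇔; Equivalence)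
open import Relation.Binary.PropositionalEquality
  using (_≡_; _≢_; refl; sym; trans; cong; cong₂; module ≡-Reasoning)
open import Relation.Nullary using (¬_; Dec; yes; no; contradiction)
open import Relation.Nullary.Decidable using (_×-dec_; _⊎-dec_; decidable-stable)

private
  variable
    n : ℕ

count : (Fin n → Bool) → ℕ
count f = ∑ (b2n ∘ f)

sum-tabulate : (f : Fin n → ℕ) → sum (tabulate f) ≡ ∑ f
sum-tabulate {0}     f = refl
sum-tabulate {suc n} f = cong (f zero +_) (sum-tabulate (f ∘ suc))

sum-map-allFin : (f : Fin n → ℕ) → sum (map f (allFin n)) ≡ ∑ f
sum-map-allFin f = trans (cong sum (map-tabulate (λ x → x) f)) (sum-tabulate f)

indeg-count : (G : LoopDigraph n) (v : Fin n) → indeg G v ≡ count (λ x → G x v)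
indeg-count G v = sum-map-allFin (λ x → b2n (G x v))

outdeg-count : (G : LoopDigraph n) (v : Fin n) → outdeg G v ≡ count (G v)
outdeg-count G v = sum-map-allFin (b2n ∘ G v)

count-cong : {f g : Fin n → Bool} → (∀ x → f x ≡ g x) → count f ≡ count g
count-cong f≗g = sum-cong-≗ (cong b2n ∘ f≗g)

count-flip : {f g : Fin n → Bool} (p : Fin n) → (∀ x → x ≢ p → f x ≡ g x) →
             f p ≡ true → g p ≡ false → count f ≡ suc (count g)
count-flip {suc _} {f} {g} p f≗g fp gp = begin
  count f                                 ≡⟨ sum-remove (b2n ∘ f) ⟩
  b2n (f p) + count (f ∘ punchIn p)       ≡⟨ cong₂ _+_ (cong b2n fp)
                                                       (count-cong (λ x → f≗g _ (punchInᵢ≢i p x))) ⟩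
  1 + count (g ∘ punchIn p)               ≡⟨ cong (λ b → suc (b2n b + count (g ∘ punchIn p))) (sym gp) ⟩
  suc (b2n (g p) + count (g ∘ punchIn p)) ≡⟨ cong suc (sym (sum-remove (b2n ∘ g))) ⟩
  suc (count g)                           ∎
  where open ≡-Reasoning

-- f ∨ g is one flip away from each of f and g.
count-swap : {f g : Fin n → Bool} (p q : Fin n) → (∀ x → x ≢ p → x ≢ q → f x ≡ g x) →
             f p ≡ true → f q ≡ false → g p ≡ false → g q ≡ true → count f ≡ count g
count-swap {f = f} {g} p q f≗g fp fq gp gq =
  suc-injective (trans (sym (count-flip q ∨≗f (trans (cong (_∨ g q) fq) gq) fq))
                       (count-flip p ∨≗g (cong (_∨ g p) fp) gp))
  where
  ∨≗f : ∀ x → x ≢ q → f x ∨ g x ≡ f x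
  ∨≗f x x≢q with x ≟ p
  ... | yes refl = trans (cong (_∨ g x) fp) (sym fp)
  ... | no x≢p   = trans (cong (f x ∨_) (sym (f≗g x x≢p x≢q))) (∨-idem (f x))
  ∨≗g : ∀ x → x ≢ p → f x ∨ g x ≡ g x
  ∨≗g x x≢p with x ≟ q
  ... | yes refl = trans (cong (f x ∨_) gq) (trans (∨-zeroʳ (f x)) (sym gq))
  ... | no x≢q   = trans (cong (_∨ g x) (f≗g x x≢p x≢q)) (∨-idem (g x))

indeg-cong : {G H : LoopDigraph n} {v : Fin n} → (∀ x → G x v ≡ H x v) → indeg G v ≡ indeg H v
indeg-cong {G = G} {H} {v} G≗H =
  trans (indeg-count G v) (trans (count-cong G≗H) (sym (indeg-count H v)))

outdeg-cong : {G H : LoopDigraph n} {v : Fin n} → (∀ y → G v y ≡ H v y) → outdeg G v ≡ outdeg H v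
outdeg-cong {G = G} {H} {v} G≗H =
  trans (outdeg-count G v) (trans (count-cong G≗H) (sym (outdeg-count H v)))

shift-preserves-row : {i j k x : Fin n} {G′ G : LoopDigraph n} →
                      ShiftAt i j k G′ G → x ≢ k → ∀ y → G x y ≡ G′ x y
shift-preserves-row (_ , _ , _ , _ , off) x≢k y = off _ y (x≢k ∘ proj₁) (x≢k ∘ proj₁)

shift-preserves-col : {i j k y : Fin n} {G′ G : LoopDigraph n} →
                      ShiftAt i j k G′ G → y ≢ i → y ≢ j → ∀ x → G x y ≡ G′ x y
shift-preserves-col (_ , _ , _ , _ , off) y≢i y≢j x = off x _ (y≢i ∘ proj₂) (y≢j ∘ proj₂)

shift-realizes : {a a′ b : DegVec n} {i j k : Fin n} {G′ G : LoopDigraph n} →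
                 UnitTransfer i j a′ a → Realizes G′ a′ b → ShiftAt i j k G′ G → Realizes G a b
shift-realizes {a = a} {a′} {b} {i} {j} {k} {G′} {G}
               (_ , _ , aᵢ+1≡a′ᵢ , aⱼ≡a′ⱼ+1 , a≡a′) (in′ , out′)
               s@(g′ki , g′kj , gki , gkj , _) =
  indeg≡ , outdeg≡
  where
  open ≡-Reasoning
  col : LoopDigraph n → Fin n → Fin n → Bool
  col H v x = H x v

  indeg≡ : ∀ v → indeg G v ≡ a v
  indeg≡ v with v ≟ i | v ≟ j
  ... | yes refl | _ = suc-injective (begin
    suc (indeg G i)       ≡⟨ cong suc (indeg-count G i) ⟩
    suc (count (col G i)) ≡⟨ count-flip k (λ x x≢k → sym (shift-preserves-row s x≢k i)) g′ki gki ⟨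
    count (col G′ i)      ≡⟨ trans (sym (indeg-count G′ i)) (in′ i) ⟩
    a′ i                  ≡⟨ aᵢ+1≡a′ᵢ ⟨
    a i + 1               ≡⟨ +-comm (a i) 1 ⟩
    suc (a i)             ∎)
  ... | no _ | yes refl = begin
    indeg G j              ≡⟨ indeg-count G j ⟩
    count (col G j)        ≡⟨ count-flip k (λ x x≢k → shift-preserves-row s x≢k j) gkj g′kj ⟩
    suc (count (col G′ j)) ≡⟨ cong suc (trans (sym (indeg-count G′ j)) (in′ j)) ⟩
    suc (a′ j)             ≡⟨ +-comm 1 (a′ j) ⟩
    a′ j + 1               ≡⟨ aⱼ≡a′ⱼ+1 ⟨
    a j                    ∎
  ... | no v≢i | no v≢j =
    trans (indeg-cong {G = G} {G′} (shift-preserves-col s v≢i v≢j))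
          (trans (in′ v) (sym (a≡a′ v v≢i v≢j)))

  outdeg≡ : ∀ v → outdeg G v ≡ b v
  outdeg≡ v with v ≟ k
  ... | yes refl = begin
    outdeg G k       ≡⟨ outdeg-count G k ⟩
    count (G k)      ≡⟨ count-swap i j (λ y y≢i y≢j → sym (shift-preserves-col s y≢i y≢j k))
                                  g′ki g′kj gki gkj ⟨
    count (G′ k)     ≡⟨ trans (sym (outdeg-count G′ k)) (out′ k) ⟩
    b k              ∎
  ... | no v≢k = trans (outdeg-cong {G = G} {G′} (shift-preserves-row s v≢k)) (out′ v)

shift : Fin n → Fin n → Fin n → LoopDigraph n → LoopDigraph n
shift i j k G x y with (x ≟ k) ×-dec (y ≟ i) | (x ≟ k) ×-dec (y ≟ j)
... | yes _ | _     = false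
... | no _  | yes _ = true
... | no _  | no _  = G x y

shift-ShiftAt : {i j k : Fin n} {G : LoopDigraph n} →
                G k i ≡ true → G k j ≡ false → ShiftAt i j k G (shift i j k G)
shift-ShiftAt {i = i} {j} {k} {G} gki gkj = gki , gkj , at-ki , at-kj , elsewhere
  where
  at-ki : shift i j k G k i ≡ false
  at-ki with (k ≟ k) ×-dec (i ≟ i)
  ... | yes _ = refl
  ... | no ¬p = contradiction (refl , refl) ¬p

  at-kj : shift i j k G k j ≡ true
  at-kj with (k ≟ k) ×-dec (j ≟ i) | (k ≟ k) ×-dec (j ≟ j)
  ... | yes (_ , refl) | _     = contradiction (trans (sym gki) gkj) λ ()
  ... | no _           | yes _ = refl
  ... | no _           | no ¬p = contradiction (refl , refl) ¬p

  elsewhere : ∀ x y → ¬ (x ≡ k × y ≡ i) → ¬ (x ≡ k × y ≡ j) → shift i j k G x y ≡ G x y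
  elsewhere x y ¬ki ¬kj with (x ≟ k) ×-dec (y ≟ i) | (x ≟ k) ×-dec (y ≟ j)
  ... | yes p | _     = contradiction p ¬ki
  ... | no _  | yes p = contradiction p ¬kj
  ... | no _  | no _  = refl

Switch : Fin n → Fin n → Fin n → Fin n → LoopDigraph n → LoopDigraph n → Set
Switch i j k k′ G₁ G₂ =
  k ≢ k′ ×
  (∀ x y → InSymDiff G₁ G₂ x y ⇔ InFour i j k k′ x y) ×
  (G₁ k i ≡ true) × (G₂ k i ≡ false) ×
  (G₁ k′ j ≡ true) × (G₂ k′ j ≡ false) ×
  (G₂ k j ≡ true) × (G₁ k j ≡ false) ×
  (G₂ k′ i ≡ true) × (G₁ k′ i ≡ false)

inFour? : (i j k k′ x y : Fin n) → Dec (InFour i j k k′ x y)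
inFour? i j k k′ x y =
  (x ≟ k) ×-dec (y ≟ i) ⊎-dec (x ≟ k′) ×-dec (y ≟ j) ⊎-dec
  (x ≟ k) ×-dec (y ≟ j) ⊎-dec (x ≟ k′) ×-dec (y ≟ i)

true≢false-at : {u v : Bool} → u ≡ true → v ≡ false → u ≢ v
true≢false-at refl refl ()

common-shift-agree : {i j k k′ : Fin n} {G₁ G₂ G : LoopDigraph n} →
                     ShiftAt i j k G₁ G → ShiftAt i j k′ G₂ G →
                     ∀ x y → ¬ InFour i j k k′ x y → G₁ x y ≡ G₂ x y
common-shift-agree (_ , _ , _ , _ , off₁) (_ , _ , _ , _ , off₂) x y ∉ =
  trans (sym (off₁ x y (∉ ∘ inj₁) (∉ ∘ inj₂ ∘ inj₂ ∘ inj₁)))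
        (off₂ x y (∉ ∘ inj₂ ∘ inj₂ ∘ inj₂) (∉ ∘ inj₂ ∘ inj₁))

common-shift-same-row : {i j k : Fin n} {G₁ G₂ G : LoopDigraph n} →
                        ShiftAt i j k G₁ G → ShiftAt i j k G₂ G → SameGraph G₁ G₂
common-shift-same-row {i = i} {j} {k} s₁@(g₁ki , g₁kj , _) s₂@(g₂ki , g₂kj , _) x y
  with inFour? i j k k x y
... | yes (inj₁ (refl , refl))               = trans g₁ki (sym g₂ki)
... | yes (inj₂ (inj₁ (refl , refl)))        = trans g₁kj (sym g₂kj)
... | yes (inj₂ (inj₂ (inj₁ (refl , refl)))) = trans g₁kj (sym g₂kj)
... | yes (inj₂ (inj₂ (inj₂ (refl , refl)))) = trans g₁ki (sym g₂ki)
... | no ∉                                   = common-shift-agree s₁ s₂ x y ∉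

common-shift⇒switch : {i j k k′ : Fin n} {G₁ G₂ G : LoopDigraph n} → ¬ SameGraph G₁ G₂ →
                      ShiftAt i j k G₁ G → ShiftAt i j k′ G₂ G → Switch i j k k′ G₁ G₂
common-shift⇒switch {i = i} {j} {k} {k′} {G₁} {G₂} G₁≠G₂
                    s₁@(g₁ki , g₁kj , gki , gkj , _) s₂@(g₂k′i , g₂k′j , gk′i , gk′j , _) =
  k≢k′ , (λ x y → mk⇔ (differ⇒four x y) four⇒differ) ,
  g₁ki , g₂ki , g₁k′j , g₂k′j , g₂kj , g₁kj , g₂k′i , g₁k′i
  where
  k≢k′ : k ≢ k′
  k≢k′ refl = G₁≠G₂ (common-shift-same-row s₁ s₂)
  g₂ki : G₂ k i ≡ false
  g₂ki = trans (sym (shift-preserves-row s₂ k≢k′ i)) gki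
  g₂kj : G₂ k j ≡ true
  g₂kj = trans (sym (shift-preserves-row s₂ k≢k′ j)) gkj
  g₁k′i : G₁ k′ i ≡ false
  g₁k′i = trans (sym (shift-preserves-row s₁ (k≢k′ ∘ sym) i)) gk′i
  g₁k′j : G₁ k′ j ≡ true
  g₁k′j = trans (sym (shift-preserves-row s₁ (k≢k′ ∘ sym) j)) gk′j

  differ⇒four : ∀ x y → InSymDiff G₁ G₂ x y → InFour i j k k′ x y
  differ⇒four x y d = decidable-stable (inFour? i j k k′ x y) (d ∘ common-shift-agree s₁ s₂ x y)

  four⇒differ : ∀ {x y} → InFour i j k k′ x y → InSymDiff G₁ G₂ x y
  four⇒differ (inj₁ (refl , refl))               = true≢false-at g₁ki g₂ki
  four⇒differ (inj₂ (inj₁ (refl , refl)))        = true≢false-at g₁k′j g₂k′j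
  four⇒differ (inj₂ (inj₂ (inj₁ (refl , refl)))) = true≢false-at g₂kj g₁kj ∘ sym
  four⇒differ (inj₂ (inj₂ (inj₂ (refl , refl)))) = true≢false-at g₂k′i g₁k′i ∘ sym

switch⇒shift : {i j k k′ : Fin n} {G₁ G₂ G : LoopDigraph n} →
               Switch i j k k′ G₁ G₂ → ShiftAt i j k G₁ G → ShiftAt i j k′ G₂ G
switch⇒shift {i = i} {j} {k} {k′} {G₁} {G₂} {G}
             (k≢k′ , sd , _ , g₂ki , g₁k′j , g₂k′j , g₂kj , _ , g₂k′i , g₁k′i)
             s₁@(_ , _ , gki , gkj , off₁) =
  g₂k′i , g₂k′j ,
  trans (shift-preserves-row s₁ (k≢k′ ∘ sym) i) g₁k′i ,
  trans (shift-preserves-row s₁ (k≢k′ ∘ sym) j) g₁k′j ,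
  off₂
  where
  agree : ∀ x y → ¬ InFour i j k k′ x y → G₁ x y ≡ G₂ x y
  agree x y ∉ = decidable-stable (G₁ x y ≟ᴮ G₂ x y) (∉ ∘ Equivalence.to (sd x y))

  off₂ : ∀ x y → ¬ (x ≡ k′ × y ≡ i) → ¬ (x ≡ k′ × y ≡ j) → G x y ≡ G₂ x y
  off₂ x y ¬k′i ¬k′j with inFour? i j k k′ x y
  ... | yes (inj₁ (refl , refl))               = trans gki (sym g₂ki)
  ... | yes (inj₂ (inj₁ p))                    = contradiction p ¬k′j
  ... | yes (inj₂ (inj₂ (inj₁ (refl , refl)))) = trans gkj (sym g₂kj)
  ... | yes (inj₂ (inj₂ (inj₂ p)))             = contradiction p ¬k′i
  ... | no ∉ = trans (off₁ x y (∉ ∘ inj₁) (∉ ∘ inj₂ ∘ inj₂ ∘ inj₁)) (agree x y ∉)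

switch⇒common-shift : {a a′ b : DegVec n} {i j k k′ : Fin n} {G₁ G₂ : LoopDigraph n} →
                      UnitTransfer i j a′ a → Realizes G₁ a′ b → Switch i j k k′ G₁ G₂ →
                      ∃[ G ] (InShift i j G₁ a b G × InShift i j G₂ a b G)
switch⇒common-shift {a = a} {b = b} {i} {j} {k} {k′} {G₁}
                    transfer R₁ sw@(_ , _ , g₁ki , _ , _ , _ , _ , g₁kj , _) =
  shift i j k G₁ , (R , k , s₁) , (R , k′ , switch⇒shift sw s₁)
  where
  s₁ : ShiftAt i j k G₁ (shift i j k G₁)
  s₁ = shift-ShiftAt g₁ki g₁kj
  R : Realizes (shift i j k G₁) a b
  R = shift-realizes transfer R₁ s₁

proposition1 : ∀ (n : ℕ) (a a' b : DegVec n) (i j : Fin n) →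
  LoopDigraphic a b → LoopDigraphic a' b →
  ¬ (∀ v → a v ≡ a' v) →
  UnitTransfer i j a' a →
  (G₁ G₂ : LoopDigraph n) → Realizes G₁ a' b → Realizes G₂ a' b →
  ¬ SameGraph G₁ G₂ →
  (∃[ G ] (InShift i j G₁ a b G × InShift i j G₂ a b G))
  ⇔
  (∃[ k ] ∃[ k' ] (k ≢ k' ×
     (∀ x y → InSymDiff G₁ G₂ x y ⇔ InFour i j k k' x y) ×
     (G₁ k i ≡ true) × (G₂ k i ≡ false) ×
     (G₁ k' j ≡ true) × (G₂ k' j ≡ false) ×
     (G₂ k j ≡ true) × (G₁ k j ≡ false) ×
     (G₂ k' i ≡ true) × (G₁ k' i ≡ false)))
proposition1 n a a' b i j _ _ _ transfer G₁ G₂ R₁ _ G₁≠G₂ = mk⇔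
  (λ { (G , (_ , k , s₁) , (_ , k′ , s₂)) → k , k′ , common-shift⇒switch G₁≠G₂ s₁ s₂ })
  (λ { (k , k′ , sw) → switch⇒common-shift transfer R₁ sw })
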